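{- Let $S_{\rm lcm}(n)$ denote the set of permutations $\pi$ of $[n]=\{1,\dots,n\}$ such that $\operatorname{lcm}[j,\pi(j)]\le n$ for every $j\in[n]$. For any positive integer $b$, \[ \#S_{\rm lcm}(n)\ge \exp\big((c(b)\varphi(b)/b+o(1))\,n\big)\quad\text{as } n\to\infty, \] where $\varphi$ is Euler's totient function and $c(b)$ is defined below.
   Context: For a positive integer $b$ and a divisor $a\mid b$, let $s(a,b)=\{d\mid b: d\le a\}$, and let $p(a,b)$ be the number of permutations $\sigma$ of $s(a,b)$ such that $\operatorname{lcm}[d,\sigma(d)]\le a$ for every $d\in s(a,b)$. Let $\tau(b)$ be the number of positive divisors of $b$, and write the divisors of $b$ in increasing order as $1=a_1<a_2<\dots<a_{\tau(b)}=b$. Define \[ c(b)=\frac{\log(\tau(b)!)}{b}+\sum_{i=1}^{\tau(b)-1}\Big(\frac1{a_i}-\frac1{a_{i+1}}\Big)\log p(a_i,b). \] -}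

module Defs where

open import Data.Nat using (ℕ; zero; suc; _*_; _∸_; _^_; _≤_; _≤?_; _/_; _!)
open import Data.Nat.Divisibility using (_∣?_)
open import Data.Nat.Coprimality using (coprime?)
open import Data.Nat.LCM using (lcm)

open import Data.Nat.Properties using (_≟_)
open import Data.List using (List; []; _∷_; [_]; map; concatMap; filter; length; upTo; zip)
open import Data.Nat.ListAction using (product)
open import Data.List.Relation.Unary.All using (All)
open import Data.List.Relation.Unary.All using (all?)
open import Data.List.Relation.Unary.Unique.DecPropositional _≟_ using (unique?)
open import Data.Product using (_,_; _×_; proj₁; proj₂)
open import Relation.Nullary using (_×-dec_)

range1 : ℕ → List ℕ
range1 n = map suc (upTo n)

tuples : List ℕ → ℕ → List (List ℕ)
tuples xs zero    = [ [] ]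
tuples xs (suc k) = concatMap (λ x → map (x ∷_) (tuples xs k)) xs

-- For a list xs of DISTINCT elements, the permutations σ of xs, each encoded as
-- the list of images [σ(x₁), …, σ(xₖ)] of xs = [x₁, …, xₖ]:
-- exactly the length-k lists over xs without repetitions.
permsOf : List ℕ → List (List ℕ)
permsOf xs = filter unique? (tuples xs (length xs))

countLcmPerms : ℕ → List ℕ → ℕ
countLcmPerms a xs =
  length (filter (λ σ → all? (λ p → lcm (proj₁ p) (proj₂ p) ≤? a) (zip xs σ)) (permsOf xs))

#Slcm : ℕ → ℕ
#Slcm n = countLcmPerms n (range1 n)

divisors : ℕ → List ℕ
divisors b = filter (λ d → d ∣? b) (range1 b)

τ : ℕ → ℕ
τ b = length (divisors b)

φ : ℕ → ℕ
φ b = length (filter (λ k → coprime? k b) (range1 b))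

s : ℕ → ℕ → List ℕ
s a b = filter (λ d → (d ∣? b) ×-dec (d ≤? a)) (range1 b)

p : ℕ → ℕ → ℕ
p a b = countLcmPerms a (s a b)

-- b / d for d ≥ 1 (0 for d = 0, never used)
quot : ℕ → ℕ → ℕ
quot b zero    = zero
quot b (suc j) = b / suc j

consecutive : List ℕ → List (ℕ × ℕ)
consecutive []           = []
consecutive (x ∷ [])     = []
consecutive (x ∷ y ∷ xs) = (x , y) ∷ consecutive (y ∷ xs)

-- Q(b) = τ(b)! · ∏_{i=1}^{τ(b)-1} p(a_i,b)^(b/a_i − b/a_{i+1}),
-- so that  log Q(b) = b · c(b),  i.e. c(b) = log Q(b) / b.
Q : ℕ → ℕ
Q b = (τ b) ! * product (map (λ pr → p (proj₁ pr) b ^ (quot b (proj₁ pr) ∸ quot b (proj₂ pr)))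
                             (consecutive (divisors b)))

-- Fix M = ⌊n / b²⌋. The products m d with m coprime to b and d ∣ b determine m, so the blocks
-- m·s(a, b) for distinct such m are pairwise disjoint subsets of [n] whenever m a ≤ n. A permutation σ of
-- s(a, b) with lcm[d, σ d] ≤ a, scaled by m, permutes its block with lcm ≤ m a ≤ n; permuting every block
-- independently and fixing the rest of [n] gives distinct elements of S_lcm(n). Giving the block s(aᵢ, b) to
-- each of the φ(b) M (b/aᵢ − b/aᵢ₊₁) multipliers m coprime to b in (b M b/aᵢ₊₁, b M b/aᵢ], and s(b, b) to the
-- φ(b) M multipliers in (0, b M], keeps m a ≤ b² M ≤ n and yields #S_lcm(n) ≥ Q(b)^(φ(b) M), because every
-- permutation of the divisors of b is admissible for the bound b, so τ(b)! ≤ p(b, b). Writing n = b² M + r,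
-- the leftover factor Q(b)^(φ(b) r) is bounded, and Bernoulli's inequality absorbs it into ((k + 2)/(k + 1))ⁿ.

module Submission where

open import Defs
open import Data.Nat
  using (ℕ; zero; suc; _+_; _*_; _∸_; _^_; _≤_; _<_; _≤?_; _!; z≤n; s≤s; NonZero; >-nonZero; >-nonZero⁻¹)
open import Data.Nat.Coprimality using (Coprime; coprime?; coprime-divisor)
open import Data.Nat.Divisibility
  using (_∣_; _∣?_; ∣⇒≤; ∣-refl; ∣-trans; ∣-antisym; *-monoʳ-∣; m∣m*n; ∣m+n∣m⇒∣n)
open import Data.Nat.DivMod using (_/_; _%_; /-monoʳ-≤; m≥n⇒m/n>0; m/n*n≤m; m%n<n; m≡m%n+[m/n]*n)
open import Data.Nat.GCD using (gcd)
open import Data.Nat.LCM using (lcm; lcm-least; m∣lcm[m,n]; n∣lcm[m,n]; gcd*lcm; lcm[0,n]≡0; lcm[n,0]≡0)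
open import Data.Nat.ListAction using (product)
open import Data.Nat.ListAction.Properties using (product-++)
open import Data.Nat.Properties
open import Algebra.Properties.CommutativeSemigroup *-commutativeSemigroup
  using (xy∙z≈y∙xz; xy∙z≈xz∙y; x∙yz≈y∙xz; x∙yz≈z∙xy) renaming (interchange to *-interchange)
open import Data.Nat.Tactic.RingSolver using (solve-∀)
open import Data.List using (List; []; _∷_; [_]; map; concatMap; filter; length; zip; _++_)
open import Data.List.Properties
  using (length-map; length-++; ≡-dec; filter-≐; filter-accept; filter-reject; filter-all; filter-notAll;
         map-injective; map-∘; map-id; map-++; map-cong-local; ∷-injectiveˡ; ∷-injectiveʳ; ++-cancelˡ; zip-map)
open import Data.List.Membership.DecPropositional _≟_ using (_∈?_)
open import Data.List.Membership.Propositional using (_∈_; _∉_; find)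
open import Data.List.Membership.Propositional.Properties
  using (∈-map⁺; ∈-map⁻; ∈-concatMap⁺; ∈-concatMap⁻; ∈-filter⁺; ∈-filter⁻; ∈-upTo⁺; ∈-upTo⁻; ∈-++⁺ˡ; ∈-++⁺ʳ)
open import Data.List.Relation.Binary.Disjoint.Propositional using (Disjoint)
open import Data.List.Relation.Unary.All as All using (All; []; _∷_; all?)
import Data.List.Relation.Unary.All.Properties as All
open import Data.List.Relation.Unary.Any as Any using (here; there)
open import Data.List.Relation.Unary.Linked using (Linked; _∷_)
import Data.List.Relation.Unary.Linked.Properties as Linked
open import Data.List.Relation.Unary.Unique.DecPropositional _≟_ using (unique?)
open import Data.List.Relation.Unary.Unique.Propositional using (Unique; []; _∷_)
import Data.List.Relation.Unary.Unique.Propositional.Properties as Unique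
open import Data.List.Relation.Unary.Unique.Propositional.Properties using (Unique[x∷xs]⇒x∉xs)
open import Data.Product using (∃-syntax; _×_; _,_; proj₁; proj₂; uncurry)
import Data.Product as Product
open import Data.Sum using (_⊎_; inj₁; inj₂)
open import Function using (_∘_)
open import Relation.Binary.Definitions using (DecidableEquality)
open import Relation.Binary.PropositionalEquality using (_≡_; _≢_; refl; sym; trans; cong; cong₂; subst; module ≡-Reasoning)
open import Relation.Nullary using (Dec; ¬?; yes; no; contradiction; _×-dec_)

module _ {A : Set} where

  unique⊆⇒length≤ : DecidableEquality A → {xs ys : List A} → Unique xs → All (_∈ ys) xs → length xs ≤ length ys
  unique⊆⇒length≤ _ {[]} _ _ = z≤n
  unique⊆⇒length≤ _≟ᴬ_ {x ∷ xs} {ys} (x∉xs ∷ xs!) (x∈ys ∷ xs⊆ys) = begin-strict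
    length xs              ≤⟨ unique⊆⇒length≤ _≟ᴬ_ xs! (All.zipWith (uncurry (∈-filter⁺ ≢x?)) (xs⊆ys , x∉xs)) ⟩
    length (filter ≢x? ys) <⟨ filter-notAll ≢x? ys (Any.map (λ x≡y x≢y → x≢y x≡y) x∈ys) ⟩
    length ys              ∎
    where
    open ≤-Reasoning
    ≢x? = λ y → ¬? (x ≟ᴬ y)

  Unique-concatMap⁺ : {B : Set} {f : A → List B} {xs : List A} → Unique xs → (∀ x → Unique (f x)) →
    (∀ {x y v} → x ∈ xs → y ∈ xs → v ∈ f x → v ∈ f y → x ≡ y) → Unique (concatMap f xs)
  Unique-concatMap⁺ {xs = []} _ _ _ = []
  Unique-concatMap⁺ {f = f} {x ∷ xs} (x∉xs ∷ xs!) f! separated =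
    Unique.++⁺ (f! x) (Unique-concatMap⁺ xs! f! (λ x∈ y∈ → separated (there x∈) (there y∈))) disjoint
    where
    disjoint : Disjoint (f x) (concatMap f xs)
    disjoint (v∈fx , v∈rest) with find (∈-concatMap⁻ f v∈rest)
    ... | y , y∈xs , v∈fy = All.lookup x∉xs y∈xs (separated (here refl) (there y∈xs) v∈fx v∈fy)

  length-concatMap : {B : Set} (f : A → List B) {c : ℕ} (xs : List A) →
    (∀ {x} → x ∈ xs → length (f x) ≡ c) → length (concatMap f xs) ≡ length xs * c
  length-concatMap f [] _ = refl
  length-concatMap f (x ∷ xs) len≡c =
    trans (length-++ (f x)) (cong₂ _+_ (len≡c (here refl)) (length-concatMap f xs (len≡c ∘ there)))

  Unique-map⁺-on : {B : Set} {P : A → Set} {f : A → B} → (∀ {x y} → P x → P y → f x ≡ f y → x ≡ y) →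
    {xs : List A} → All P xs → Unique xs → Unique (map f xs)
  Unique-map⁺-on inj [] [] = []
  Unique-map⁺-on inj (px ∷ pxs) (x∉xs ∷ xs!) =
    All.map⁺ (All.zipWith (λ (py , x≢y) fx≡fy → x≢y (inj px py fx≡fy)) (pxs , x∉xs)) ∷ Unique-map⁺-on inj pxs xs!

  map-≡⇒pointwise : {B : Set} {f g : A → B} (xs : List A) → map f xs ≡ map g xs → All (λ x → f x ≡ g x) xs
  map-≡⇒pointwise [] _ = []
  map-≡⇒pointwise (x ∷ xs) eq = ∷-injectiveˡ eq ∷ map-≡⇒pointwise xs (∷-injectiveʳ eq)

  ++-injectiveˡ : (xs ys : List A) {zs ws : List A} → length xs ≡ length ys → xs ++ zs ≡ ys ++ ws → xs ≡ ys
  ++-injectiveˡ [] [] _ _ = refl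
  ++-injectiveˡ (x ∷ xs) (y ∷ ys) len≡ eq =
    cong₂ _∷_ (∷-injectiveˡ eq) (++-injectiveˡ xs ys (suc-injective len≡) (∷-injectiveʳ eq))

  map-∷-separated : {x y : A} {v : List A} {xss yss : List (List A)} →
    v ∈ map (x ∷_) xss → v ∈ map (y ∷_) yss → x ≡ y
  map-∷-separated v∈ v∈' with ∈-map⁻ (_ ∷_) v∈ | ∈-map⁻ (_ ∷_) v∈'
  ... | _ , _ , refl | _ , _ , refl = refl

module _ {A B : Set} where

  zip-++ : (xs : List A) (ys : List B) {xs' : List A} {ys' : List B} → length xs ≡ length ys →
    zip (xs ++ xs') (ys ++ ys') ≡ zip xs ys ++ zip xs' ys'
  zip-++ [] [] _ = refl
  zip-++ (x ∷ xs) (y ∷ ys) len≡ = cong ((x , y) ∷_) (zip-++ xs ys (suc-injective len≡))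

  ∈-zip⁻ : {xs : List A} {ys : List B} {x : A} {y : B} → (x , y) ∈ zip xs ys → x ∈ xs × y ∈ ys
  ∈-zip⁻ {_ ∷ _} {_ ∷ _} (here refl) = here refl , here refl
  ∈-zip⁻ {_ ∷ _} {_ ∷ _} (there xy∈) = Product.map there there (∈-zip⁻ xy∈)

  zip-injectiveʳ : {xs : List A} {ys : List B} {x x' : A} {y : B} → Unique ys →
    (x , y) ∈ zip xs ys → (x' , y) ∈ zip xs ys → x ≡ x'
  zip-injectiveʳ {_ ∷ _} {_ ∷ _} _ (here refl) (here refl) = refl
  zip-injectiveʳ {_ ∷ _} {_ ∷ _} ys! (here refl) (there xy∈) =
    contradiction (proj₂ (∈-zip⁻ xy∈)) (Unique[x∷xs]⇒x∉xs ys!)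
  zip-injectiveʳ {_ ∷ _} {_ ∷ _} ys! (there xy∈) (here refl) =
    contradiction (proj₂ (∈-zip⁻ xy∈)) (Unique[x∷xs]⇒x∉xs ys!)
  zip-injectiveʳ {_ ∷ _} {_ ∷ _} (_ ∷ ys!) (there xy∈) (there xy∈') = zip-injectiveʳ ys! xy∈ xy∈'

  All-zip-map⁺ : {P : A × B → Set} {f : A → B} (xs : List A) →
    All (λ x → P (x , f x)) xs → All P (zip xs (map f xs))
  All-zip-map⁺ [] [] = []
  All-zip-map⁺ (x ∷ xs) (p ∷ ps) = p ∷ All-zip-map⁺ xs ps

lcm≡0⇒ : (d e : ℕ) → lcm d e ≡ 0 → d ≡ 0 ⊎ e ≡ 0
lcm≡0⇒ d e lcm≡0 = m*n≡0⇒m≡0∨n≡0 d (begin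
  d * e                 ≡⟨ sym (gcd*lcm d e) ⟩
  gcd d e * lcm d e     ≡⟨ cong (gcd d e *_) lcm≡0 ⟩
  gcd d e * 0           ≡⟨ *-zeroʳ (gcd d e) ⟩
  0                     ∎)
  where open ≡-Reasoning

lcm-*-≤ : (m d e : ℕ) → lcm (m * d) (m * e) ≤ m * lcm d e
lcm-*-≤ m d e with m * lcm d e in eq
... | suc _ = ∣⇒≤ (subst (lcm (m * d) (m * e) ∣_) eq
  (lcm-least (*-monoʳ-∣ m (m∣lcm[m,n] d e)) (*-monoʳ-∣ m (n∣lcm[m,n] d e))))
... | zero with m*n≡0⇒m≡0∨n≡0 m eq
...   | inj₁ refl = ≤-reflexive (lcm[0,n]≡0 0)
...   | inj₂ lcm≡0 with lcm≡0⇒ d e lcm≡0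
...     | inj₁ refl = ≤-reflexive (trans (cong (λ x → lcm x (m * e)) (*-zeroʳ m)) (lcm[0,n]≡0 (m * e)))
...     | inj₂ refl = ≤-reflexive (trans (cong (lcm (m * d)) (*-zeroʳ m)) (lcm[n,0]≡0 (m * d)))

lcm[x,x]≤x : (x : ℕ) → lcm x x ≤ x
lcm[x,x]≤x zero = ≤-reflexive (lcm[0,n]≡0 0)
lcm[x,x]≤x (suc x) = ∣⇒≤ (lcm-least ∣-refl ∣-refl)

coprime-factor-unique : {b m m' d d' : ℕ} → Coprime m b → Coprime m' b → d ∣ b → d' ∣ b →
  m * d ≡ m' * d' → m ≡ m'
coprime-factor-unique {b} {m} {m'} {d} {d'} m⊥b m'⊥b d∣b d'∣b md≡m'd' = ∣-antisym m∣m' m'∣m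
  where
  m∣m' : m ∣ m'
  m∣m' = coprime-divisor (λ (i∣m , i∣d') → m⊥b (i∣m , ∣-trans i∣d' d'∣b))
    (subst (m ∣_) (trans md≡m'd' (*-comm m' d')) (m∣m*n d))
  m'∣m : m' ∣ m
  m'∣m = coprime-divisor (λ (i∣m' , i∣d) → m'⊥b (i∣m' , ∣-trans i∣d d∣b))
    (subst (m' ∣_) (trans (sym md≡m'd') (*-comm m d)) (m∣m*n d'))

coprime-+-multiple : {r b : ℕ} (j : ℕ) → Coprime r b → Coprime (b * j + r) b
coprime-+-multiple j r⊥b (i∣m , i∣b) = r⊥b (∣m+n∣m⇒∣n i∣m (∣-trans i∣b (m∣m*n j)) , i∣b)

quot-antitone : (b : ℕ) {a a' : ℕ} → 1 ≤ a → a ≤ a' → quot b a' ≤ quot b a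
quot-antitone b {suc _} {suc _} _ a≤a' = /-monoʳ-≤ b a≤a'

quot-positive : {b a : ℕ} → 1 ≤ a → a ≤ b → 1 ≤ quot b a
quot-positive {a = suc _} _ a≤b = m≥n⇒m/n>0 a≤b

quot*≤ : (b a : ℕ) → quot b a * a ≤ b
quot*≤ b zero = z≤n
quot*≤ b (suc a) = m/n*n≤m b (suc a)

^-distribʳ-* : (m n o : ℕ) → (m * n) ^ o ≡ m ^ o * n ^ o
^-distribʳ-* m n zero = refl
^-distribʳ-* m n (suc o) = trans (cong (m * n *_) (^-distribʳ-* m n o)) (*-interchange m n (m ^ o) (n ^ o))

-- Bernoulli's inequality (1 + 1/(k+1))ⁿ ≥ 1 + n/(k+1), cleared of denominators.
bernoulli : (k n : ℕ) → suc k ^ n * (suc k + n) ≤ suc (suc k) ^ n * suc k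
bernoulli k zero = ≤-reflexive (cong (_+ 0) (+-identityʳ (suc k)))
bernoulli k (suc n) = begin
  suc k * suc k ^ n * (suc k + suc n)      ≡⟨ xy∙z≈y∙xz (suc k) (suc k ^ n) (suc k + suc n) ⟩
  suc k ^ n * (suc k * (suc k + suc n))    ≤⟨ *-monoʳ-≤ (suc k ^ n) (≤-trans (m≤m+n _ n) (≤-reflexive (step k n))) ⟩
  suc k ^ n * (suc (suc k) * (suc k + n))  ≡⟨ x∙yz≈y∙xz (suc k ^ n) (suc (suc k)) (suc k + n) ⟩
  suc (suc k) * (suc k ^ n * (suc k + n))  ≤⟨ *-monoʳ-≤ (suc (suc k)) (bernoulli k n) ⟩
  suc (suc k) * (suc (suc k) ^ n * suc k)  ≡⟨ sym (*-assoc (suc (suc k)) (suc (suc k) ^ n) (suc k)) ⟩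
  suc (suc k) * suc (suc k) ^ n * suc k    ∎
  where
  open ≤-Reasoning
  step : (k n : ℕ) → suc k * (suc k + suc n) + n ≡ suc (suc k) * (suc k + n)
  step = solve-∀

exp-dominates : {c k n : ℕ} → c * suc k ≤ n → c * suc k ^ n ≤ suc (suc k) ^ n
exp-dominates {c} {k} {n} c[1+k]≤n = *-cancelʳ-≤ (c * suc k ^ n) (suc (suc k) ^ n) (suc k) (begin
  c * suc k ^ n * suc k      ≡⟨ xy∙z≈y∙xz c (suc k ^ n) (suc k) ⟩
  suc k ^ n * (c * suc k)    ≤⟨ *-monoʳ-≤ (suc k ^ n) (≤-trans c[1+k]≤n (m≤n+m n (suc k))) ⟩
  suc k ^ n * (suc k + n)    ≤⟨ bernoulli k n ⟩
  suc (suc k) ^ n * suc k    ∎)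
  where open ≤-Reasoning

-- Permutations with bounded lcm

∈-range1⁺ : {n x : ℕ} → 1 ≤ x → x ≤ n → x ∈ range1 n
∈-range1⁺ {x = suc x} _ x≤n = ∈-map⁺ suc (∈-upTo⁺ x≤n)

∈-range1⁻ : {n x : ℕ} → x ∈ range1 n → 1 ≤ x × x ≤ n
∈-range1⁻ x∈ with ∈-map⁻ suc x∈
... | _ , i∈ , refl = s≤s z≤n , ∈-upTo⁻ i∈

Unique-range1 : (n : ℕ) → Unique (range1 n)
Unique-range1 n = Unique.map⁺ suc-injective (Unique.upTo⁺ n)

∈-tuples⁺ : (xs : List ℕ) {ys : List ℕ} → All (_∈ xs) ys → ys ∈ tuples xs (length ys)
∈-tuples⁺ xs [] = here refl
∈-tuples⁺ xs {y ∷ ys} (y∈xs ∷ ys⊆xs) =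
  ∈-concatMap⁺ (λ x → map (x ∷_) (tuples xs (length ys)))
    (Any.map (λ { refl → ∈-map⁺ (y ∷_) (∈-tuples⁺ xs ys⊆xs) }) y∈xs)

∈-tuples⁻ : (xs : List ℕ) (k : ℕ) {ys : List ℕ} → ys ∈ tuples xs k → length ys ≡ k × All (_∈ xs) ys
∈-tuples⁻ xs zero (here refl) = refl , []
∈-tuples⁻ xs (suc k) ys∈ with find (∈-concatMap⁻ (λ x → map (x ∷_) (tuples xs k)) {xs = xs} ys∈)
... | x , x∈xs , ys∈x∷ with ∈-map⁻ (x ∷_) ys∈x∷
... | zs , zs∈ , refl with ∈-tuples⁻ xs k zs∈
... | len≡ , zs⊆xs = cong suc len≡ , x∈xs ∷ zs⊆xs

Unique-tuples : {xs : List ℕ} (k : ℕ) → Unique xs → Unique (tuples xs k)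
Unique-tuples zero _ = [] ∷ []
Unique-tuples (suc k) xs! =
  Unique-concatMap⁺ xs! (λ x → Unique.map⁺ ∷-injectiveʳ (Unique-tuples k xs!)) (λ _ _ → map-∷-separated)

remove : ℕ → List ℕ → List ℕ
remove x = filter (λ y → ¬? (x ≟ y))

length-remove : {x : ℕ} {xs : List ℕ} → Unique xs → x ∈ xs → suc (length (remove x xs)) ≡ length xs
length-remove {x} {y ∷ ys} (y∉ys ∷ _) (here refl) =
  cong (suc ∘ length) (trans (filter-reject (λ y → ¬? (x ≟ y)) (λ x≢x → x≢x refl))
                             (filter-all (λ y → ¬? (x ≟ y)) y∉ys))
length-remove {x} {y ∷ ys} (y∉ys ∷ ys!) (there x∈ys) =
  trans (cong (suc ∘ length) (filter-accept (λ y → ¬? (x ≟ y)) (λ x≡y → All.lookup y∉ys x∈ys (sym x≡y))))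
        (cong suc (length-remove ys! x∈ys))

distinctTuples : ℕ → List ℕ → List (List ℕ)
distinctTuples zero _ = [ [] ]
distinctTuples (suc k) xs = concatMap (λ x → map (x ∷_) (distinctTuples k (remove x xs))) xs

∈-distinctTuples⁻ : (k : ℕ) {xs ρ : List ℕ} → ρ ∈ distinctTuples k xs →
  Unique ρ × All (_∈ xs) ρ × length ρ ≡ k
∈-distinctTuples⁻ zero (here refl) = [] , [] , refl
∈-distinctTuples⁻ (suc k) {xs} ρ∈
  with find (∈-concatMap⁻ (λ x → map (x ∷_) (distinctTuples k (remove x xs))) {xs = xs} ρ∈)
... | x , x∈xs , ρ∈x∷ with ∈-map⁻ (x ∷_) ρ∈x∷
... | ρ' , ρ'∈ , refl with ∈-distinctTuples⁻ k ρ'∈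
... | ρ'! , ρ'⊆ , len≡ =
  All.map (proj₂ ∘ removed) ρ'⊆ ∷ ρ'! , x∈xs ∷ All.map (proj₁ ∘ removed) ρ'⊆ , cong suc len≡
  where
  removed : ∀ {y} → y ∈ remove x xs → y ∈ xs × x ≢ y
  removed = ∈-filter⁻ (λ y → ¬? (x ≟ y))

Unique-distinctTuples : (k : ℕ) {xs : List ℕ} → Unique xs → Unique (distinctTuples k xs)
Unique-distinctTuples zero _ = [] ∷ []
Unique-distinctTuples (suc k) {xs} xs! =
  Unique-concatMap⁺ xs! (λ x → Unique.map⁺ ∷-injectiveʳ (Unique-distinctTuples k (Unique.filter⁺ _ xs!)))
    (λ _ _ → map-∷-separated)

length-distinctTuples : (k : ℕ) {xs : List ℕ} → Unique xs → length xs ≡ k → length (distinctTuples k xs) ≡ k !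
length-distinctTuples zero _ _ = refl
length-distinctTuples (suc k) {xs} xs! len≡ =
  trans (length-concatMap (λ x → map (x ∷_) (distinctTuples k (remove x xs))) xs length-branch) (cong (_* k !) len≡)
  where
  length-branch : ∀ {x} → x ∈ xs → length (map (x ∷_) (distinctTuples k (remove x xs))) ≡ k !
  length-branch {x} x∈ = trans (length-map (x ∷_) (distinctTuples k (remove x xs)))
    (length-distinctTuples k (Unique.filter⁺ _ xs!) (suc-injective (trans (length-remove xs! x∈) len≡)))

record LcmPerm (a : ℕ) (xs σ : List ℕ) : Set where
  field
    unique : Unique σ
    ⊆xs : All (_∈ xs) σ
    length≡ : length σ ≡ length xs
    lcm≤ : All (λ p → lcm (proj₁ p) (proj₂ p) ≤ a) (zip xs σ)

lcmBounded? : (a : ℕ) (xs σ : List ℕ) → Dec (All (λ p → lcm (proj₁ p) (proj₂ p) ≤ a) (zip xs σ))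
lcmBounded? a xs σ = all? (λ p → lcm (proj₁ p) (proj₂ p) ≤? a) (zip xs σ)

lcmPerms : ℕ → List ℕ → List (List ℕ)
lcmPerms a xs = filter (lcmBounded? a xs) (permsOf xs)

∈-lcmPerms⁺ : {a : ℕ} {xs σ : List ℕ} → LcmPerm a xs σ → σ ∈ lcmPerms a xs
∈-lcmPerms⁺ {a} {xs} {σ} π = ∈-filter⁺ (lcmBounded? a xs) (∈-filter⁺ unique? σ∈tuples unique) lcm≤
  where
  open LcmPerm π
  σ∈tuples : σ ∈ tuples xs (length xs)
  σ∈tuples = subst (λ k → σ ∈ tuples xs k) length≡ (∈-tuples⁺ xs ⊆xs)

∈-lcmPerms⁻ : {a : ℕ} {xs σ : List ℕ} → σ ∈ lcmPerms a xs → LcmPerm a xs σ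
∈-lcmPerms⁻ {a} {xs} σ∈ with ∈-filter⁻ (lcmBounded? a xs) {xs = permsOf xs} σ∈
... | σ∈perms , lcm≤ with ∈-filter⁻ unique? {xs = tuples xs (length xs)} σ∈perms
... | σ∈tuples , σ! with ∈-tuples⁻ xs (length xs) σ∈tuples
... | len≡ , σ⊆xs = record { unique = σ! ; ⊆xs = σ⊆xs ; length≡ = len≡ ; lcm≤ = lcm≤ }

Unique-lcmPerms : {a : ℕ} {xs : List ℕ} → Unique xs → Unique (lcmPerms a xs)
Unique-lcmPerms {xs = xs} xs! = Unique.filter⁺ _ (Unique.filter⁺ unique? (Unique-tuples (length xs) xs!))

LcmPerm-++ : {n : ℕ} {E₁ E₂ σ₁ σ₂ : List ℕ} → Disjoint E₁ E₂ →
  LcmPerm n E₁ σ₁ → LcmPerm n E₂ σ₂ → LcmPerm n (E₁ ++ E₂) (σ₁ ++ σ₂)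
LcmPerm-++ {E₁ = E₁} {σ₁ = σ₁} {σ₂} E₁∩E₂≡∅ π₁ π₂ = record
  { unique = Unique.++⁺ (unique π₁) (unique π₂)
      λ (v∈σ₁ , v∈σ₂) → E₁∩E₂≡∅ (All.lookup (⊆xs π₁) v∈σ₁ , All.lookup (⊆xs π₂) v∈σ₂)
  ; ⊆xs = All.++⁺ (All.map ∈-++⁺ˡ (⊆xs π₁)) (All.map (∈-++⁺ʳ E₁) (⊆xs π₂))
  ; length≡ = trans (length-++ σ₁) (trans (cong₂ _+_ (length≡ π₁) (length≡ π₂)) (sym (length-++ E₁)))
  ; lcm≤ = subst (All _) (sym (zip-++ E₁ σ₁ (sym (length≡ π₁)))) (All.++⁺ (lcm≤ π₁) (lcm≤ π₂))
  }
  where open LcmPerm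

LcmPerm-scale : {a : ℕ} {xs σ : List ℕ} (m : ℕ) .{{_ : NonZero m}} →
  LcmPerm a xs σ → LcmPerm (m * a) (map (m *_) xs) (map (m *_) σ)
LcmPerm-scale {a} {xs} {σ} m π = record
  { unique = Unique.map⁺ (*-cancelˡ-≡ _ _ m) unique
  ; ⊆xs = All.map⁺ (All.map (∈-map⁺ (m *_)) ⊆xs)
  ; length≡ = trans (length-map (m *_) σ) (trans length≡ (sym (length-map (m *_) xs)))
  ; lcm≤ = subst (All _) (sym (zip-map (m *_) (m *_) xs σ))
      (All.map⁺ (All.map (λ {(d , e)} lcm≤a → ≤-trans (lcm-*-≤ m d e) (*-monoʳ-≤ m lcm≤a)) lcm≤))
  }
  where open LcmPerm π

LcmPerm-mono : {a n : ℕ} {xs σ : List ℕ} → a ≤ n → LcmPerm a xs σ → LcmPerm n xs σ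
LcmPerm-mono a≤n π = record { LcmPerm π ; lcm≤ = All.map (λ lcm≤a → ≤-trans lcm≤a a≤n) (LcmPerm.lcm≤ π) }

look : List ℕ → List ℕ → ℕ → ℕ
look (d ∷ E) (e ∷ σ) x with x ≟ d
... | yes _ = e
... | no _ = look E σ x
look _ _ x = x

look-here : (d : ℕ) (E : List ℕ) (e : ℕ) (σ : List ℕ) → look (d ∷ E) (e ∷ σ) d ≡ e
look-here d E e σ with d ≟ d
... | yes _ = refl
... | no d≢d = contradiction refl d≢d

look-there : {x d e : ℕ} {E σ : List ℕ} → x ≢ d → look (d ∷ E) (e ∷ σ) x ≡ look E σ x
look-there {x} {d} x≢d with x ≟ d
... | yes x≡d = contradiction x≡d x≢d
... | no _ = refl

look-∉ : {E σ : List ℕ} {x : ℕ} → x ∉ E → look E σ x ≡ x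
look-∉ {[]} _ = refl
look-∉ {_ ∷ _} {[]} _ = refl
look-∉ {_ ∷ _} {_ ∷ _} x∉ = trans (look-there (x∉ ∘ here)) (look-∉ (x∉ ∘ there))

look-∈zip : {E σ : List ℕ} {x : ℕ} → length σ ≡ length E → x ∈ E → (x , look E σ x) ∈ zip E σ
look-∈zip {d ∷ E} {e ∷ σ} {x} len≡ x∈ with x ≟ d
... | yes refl = here refl
... | no x≢d = there (look-∈zip (suc-injective len≡) (Any.tail x≢d x∈))

map-look : {E σ : List ℕ} → Unique E → length σ ≡ length E → map (look E σ) E ≡ σ
map-look {[]} {[]} _ _ = refl
map-look {d ∷ E} {e ∷ σ} (d∉E ∷ E!) len≡ = cong₂ _∷_ (look-here d E e σ) (begin
  map (look (d ∷ E) (e ∷ σ)) E  ≡⟨ map-cong-local (All.map (λ d≢x → look-there (d≢x ∘ sym)) d∉E) ⟩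
  map (look E σ) E              ≡⟨ map-look E! (suc-injective len≡) ⟩
  σ                             ∎)
  where open ≡-Reasoning

module _ {n : ℕ} {E σ : List ℕ} (π : LcmPerm n E σ) where
  open LcmPerm π

  look-∈ : {x : ℕ} → x ∈ E → look E σ x ∈ E
  look-∈ x∈ = All.lookup ⊆xs (proj₂ (∈-zip⁻ (look-∈zip length≡ x∈)))

  look-injective : {x y : ℕ} → look E σ x ≡ look E σ y → x ≡ y
  look-injective {x} {y} eq with x ∈? E | y ∈? E
  ... | yes x∈ | yes y∈ =
    zip-injectiveʳ unique (look-∈zip length≡ x∈) (subst (λ v → (y , v) ∈ zip E σ) (sym eq) (look-∈zip length≡ y∈))
  ... | yes x∈ | no y∉ = contradiction (subst (_∈ E) (trans eq (look-∉ y∉)) (look-∈ x∈)) y∉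
  ... | no x∉ | yes y∈ = contradiction (subst (_∈ E) (trans (sym eq) (look-∉ x∉)) (look-∈ y∈)) x∉
  ... | no x∉ | no y∉ = trans (sym (look-∉ x∉)) (trans eq (look-∉ y∉))

  LcmPerm-extend : All (_∈ range1 n) E → LcmPerm n (range1 n) (map (look E σ) (range1 n))
  LcmPerm-extend E⊆[n] = record
    { unique = Unique.map⁺ look-injective (Unique-range1 n)
    ; ⊆xs = All.map⁺ (All.tabulate image∈[n])
    ; length≡ = length-map (look E σ) (range1 n)
    ; lcm≤ = All-zip-map⁺ (range1 n) (All.tabulate lcm-image≤)
    }
    where
    image∈[n] : {x : ℕ} → x ∈ range1 n → look E σ x ∈ range1 n
    image∈[n] {x} x∈ with x ∈? E
    ... | yes x∈E = All.lookup E⊆[n] (look-∈ x∈E)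
    ... | no x∉E = subst (_∈ range1 n) (sym (look-∉ x∉E)) x∈
    lcm-image≤ : {x : ℕ} → x ∈ range1 n → lcm x (look E σ x) ≤ n
    lcm-image≤ {x} x∈ with x ∈? E
    ... | yes x∈E = All.lookup lcm≤ (look-∈zip length≡ x∈E)
    ... | no x∉E = subst (λ y → lcm x y ≤ n) (sym (look-∉ x∉E)) (≤-trans (lcm[x,x]≤x x) (proj₂ (∈-range1⁻ x∈)))

extend-injective : {n : ℕ} {E σ σ' : List ℕ} → Unique E → All (_∈ range1 n) E →
  LcmPerm n E σ → LcmPerm n E σ' → map (look E σ) (range1 n) ≡ map (look E σ') (range1 n) → σ ≡ σ'
extend-injective {n} {E} {σ} {σ'} E! E⊆[n] π π' eq = begin
  σ                   ≡⟨ sym (map-look E! (LcmPerm.length≡ π)) ⟩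
  map (look E σ) E    ≡⟨ map-cong-local (All.anti-mono (All.lookup E⊆[n]) (map-≡⇒pointwise (range1 n) eq)) ⟩
  map (look E σ') E   ≡⟨ map-look E! (LcmPerm.length≡ π') ⟩
  σ'                  ∎
  where open ≡-Reasoning

-- Families of permutations with bounded lcm

record LcmPermFamily (n : ℕ) (E : List ℕ) (k : ℕ) : Set where
  field
    domain-unique : Unique E
    domain⊆[n] : All (_∈ range1 n) E
    members : List (List ℕ)
    members-unique : Unique members
    members-lcmPerm : All (LcmPerm n E) members
    members-length : length members ≡ k
open LcmPermFamily

family≤count : {a k : ℕ} {xs : List ℕ} → LcmPermFamily a xs k → k ≤ countLcmPerms a xs
family≤count F = subst (_≤ _) (members-length F)
  (unique⊆⇒length≤ (≡-dec _≟_) (members-unique F) (All.map ∈-lcmPerms⁺ (members-lcmPerm F)))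

lcmPermsFamily : {a : ℕ} {xs : List ℕ} → Unique xs → All (_∈ range1 a) xs → LcmPermFamily a xs (countLcmPerms a xs)
lcmPermsFamily {a} {xs} xs! xs⊆[a] = record
  { domain-unique = xs!
  ; domain⊆[n] = xs⊆[a]
  ; members = lcmPerms a xs
  ; members-unique = Unique-lcmPerms xs!
  ; members-lcmPerm = All.tabulate ∈-lcmPerms⁻
  ; members-length = refl
  }

emptyFamily : {n : ℕ} → LcmPermFamily n [] 1
emptyFamily = record
  { domain-unique = []
  ; domain⊆[n] = []
  ; members = [ [] ]
  ; members-unique = [] ∷ []
  ; members-lcmPerm = record { unique = [] ; ⊆xs = [] ; length≡ = refl ; lcm≤ = [] } ∷ []
  ; members-length = refl
  }

family-++ : {n k₁ k₂ : ℕ} {E₁ E₂ : List ℕ} → Disjoint E₁ E₂ →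
  LcmPermFamily n E₁ k₁ → LcmPermFamily n E₂ k₂ → LcmPermFamily n (E₁ ++ E₂) (k₁ * k₂)
family-++ {n} {E₁ = E₁} {E₂} E₁∩E₂≡∅ F₁ F₂ = record
  { domain-unique = Unique.++⁺ (domain-unique F₁) (domain-unique F₂) E₁∩E₂≡∅
  ; domain⊆[n] = All.++⁺ (domain⊆[n] F₁) (domain⊆[n] F₂)
  ; members = concatMap prefix (members F₁)
  ; members-unique =
      Unique-concatMap⁺ (members-unique F₁) (λ σ₁ → Unique.map⁺ (++-cancelˡ σ₁ _ _) (members-unique F₂)) separated
  ; members-lcmPerm = All.tabulate lcmPerm
  ; members-length = trans (length-concatMap prefix (members F₁) (λ {σ₁} _ → length-map (σ₁ ++_) (members F₂)))
                           (cong₂ _*_ (members-length F₁) (members-length F₂))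
  }
  where
  prefix : List ℕ → List (List ℕ)
  prefix σ₁ = map (σ₁ ++_) (members F₂)
  length≡E₁ : ∀ {σ₁} → σ₁ ∈ members F₁ → length σ₁ ≡ length E₁
  length≡E₁ σ₁∈ = LcmPerm.length≡ (All.lookup (members-lcmPerm F₁) σ₁∈)
  separated : ∀ {σ₁ σ₁' τ} → σ₁ ∈ members F₁ → σ₁' ∈ members F₁ → τ ∈ prefix σ₁ → τ ∈ prefix σ₁' → σ₁ ≡ σ₁'
  separated {σ₁} {σ₁'} σ₁∈ σ₁'∈ τ∈ τ∈' with ∈-map⁻ (σ₁ ++_) τ∈ | ∈-map⁻ (σ₁' ++_) τ∈'
  ... | _ , _ , refl | _ , _ , eq = ++-injectiveˡ σ₁ σ₁' (trans (length≡E₁ σ₁∈) (sym (length≡E₁ σ₁'∈))) eq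
  lcmPerm : ∀ {τ} → τ ∈ concatMap prefix (members F₁) → LcmPerm n (E₁ ++ E₂) τ
  lcmPerm τ∈ with find (∈-concatMap⁻ prefix {xs = members F₁} τ∈)
  ... | σ₁ , σ₁∈ , τ∈' with ∈-map⁻ (σ₁ ++_) τ∈'
  ... | σ₂ , σ₂∈ , refl =
    LcmPerm-++ E₁∩E₂≡∅ (All.lookup (members-lcmPerm F₁) σ₁∈) (All.lookup (members-lcmPerm F₂) σ₂∈)

family-scale : {a k : ℕ} {xs : List ℕ} (m : ℕ) .{{_ : NonZero m}} →
  LcmPermFamily a xs k → LcmPermFamily (m * a) (map (m *_) xs) k
family-scale {xs = xs} m F = record
  { domain-unique = Unique.map⁺ (*-cancelˡ-≡ _ _ m) (domain-unique F)
  ; domain⊆[n] = All.map⁺ (All.map scale∈ (domain⊆[n] F))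
  ; members = map (map (m *_)) (members F)
  ; members-unique = Unique.map⁺ (map-injective (*-cancelˡ-≡ _ _ m)) (members-unique F)
  ; members-lcmPerm = All.map⁺ (All.map (LcmPerm-scale m) (members-lcmPerm F))
  ; members-length = trans (length-map (map (m *_)) (members F)) (members-length F)
  }
  where
  scale∈ : ∀ {x a} → x ∈ range1 a → m * x ∈ range1 (m * a)
  scale∈ x∈ with ∈-range1⁻ x∈
  ... | 1≤x , x≤a = ∈-range1⁺ (*-mono-≤ (>-nonZero⁻¹ m) 1≤x) (*-monoʳ-≤ m x≤a)

family-mono : {a n k : ℕ} {xs : List ℕ} → a ≤ n → LcmPermFamily a xs k → LcmPermFamily n xs k
family-mono a≤n F = record
  { domain-unique = domain-unique F
  ; domain⊆[n] = All.map (λ x∈ → let 1≤x , x≤a = ∈-range1⁻ x∈ in ∈-range1⁺ 1≤x (≤-trans x≤a a≤n)) (domain⊆[n] F)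
  ; members = members F
  ; members-unique = members-unique F
  ; members-lcmPerm = All.map (LcmPerm-mono a≤n) (members-lcmPerm F)
  ; members-length = members-length F
  }

family≤#Slcm : {n k : ℕ} {E : List ℕ} → LcmPermFamily n E k → k ≤ #Slcm n
family≤#Slcm {n} {E = E} F = family≤count record
  { domain-unique = Unique-range1 n
  ; domain⊆[n] = All.tabulate (λ x∈ → x∈)
  ; members = map (λ σ → map (look E σ) (range1 n)) (members F)
  ; members-unique =
      Unique-map⁺-on (extend-injective (domain-unique F) (domain⊆[n] F)) (members-lcmPerm F) (members-unique F)
  ; members-lcmPerm = All.map⁺ (All.map (λ π → LcmPerm-extend π (domain⊆[n] F)) (members-lcmPerm F))
  ; members-length = trans (length-map _ (members F)) (members-length F)
  }

completeFamily : {a : ℕ} {xs : List ℕ} → Unique xs → All (_∈ range1 a) xs →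
  (∀ {d e} → d ∈ xs → e ∈ xs → lcm d e ≤ a) → LcmPermFamily a xs (length xs !)
completeFamily {a} {xs} xs! xs⊆[a] lcm≤a = record
  { domain-unique = xs! ; domain⊆[n] = xs⊆[a]
  ; members = distinctTuples (length xs) xs
  ; members-unique = Unique-distinctTuples (length xs) xs!
  ; members-lcmPerm = All.tabulate lcmPerm
  ; members-length = length-distinctTuples (length xs) xs! refl
  }
  where
  lcmPerm : ∀ {ρ} → ρ ∈ distinctTuples (length xs) xs → LcmPerm a xs ρ
  lcmPerm ρ∈ with ∈-distinctTuples⁻ (length xs) ρ∈
  ... | ρ! , ρ⊆xs , len≡ = record { unique = ρ! ; ⊆xs = ρ⊆xs ; length≡ = len≡
    ; lcm≤ = All.tabulate λ de∈ → let d∈ , e∈ρ = ∈-zip⁻ de∈ in lcm≤a d∈ (All.lookup ρ⊆xs e∈ρ) }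

-- The block construction

module _ (b : ℕ) .{{_ : NonZero b}} where

  ∈-s⁻ : {a d : ℕ} → d ∈ s a b → d ∣ b × d ∈ range1 a
  ∈-s⁻ {a} d∈ with ∈-filter⁻ (λ d → (d ∣? b) ×-dec (d ≤? a)) {xs = range1 b} d∈
  ... | d∈[b] , d∣b , d≤a = d∣b , ∈-range1⁺ (proj₁ (∈-range1⁻ d∈[b])) d≤a

  Unique-s : (a : ℕ) → Unique (s a b)
  Unique-s a = Unique.filter⁺ _ (Unique-range1 b)

  blockDomain : ℕ × ℕ → List ℕ
  blockDomain (m , a) = map (m *_) (s a b)

  ValidBlock : ℕ → ℕ × ℕ → Set
  ValidBlock n (m , a) = Coprime m b × 1 ≤ m × m * a ≤ n

  blockFamily : {n m a : ℕ} → ValidBlock n (m , a) → LcmPermFamily n (blockDomain (m , a)) (p a b)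
  blockFamily {m = m} {a} (_ , 1≤m , ma≤n) =
    family-mono ma≤n (family-scale m {{>-nonZero 1≤m}} (lcmPermsFamily (Unique-s a) (All.tabulate (proj₂ ∘ ∈-s⁻))))

  blockCount : List (ℕ × ℕ) → ℕ
  blockCount bs = product (map (λ bl → p (proj₂ bl) b) bs)

  blocksFamily : {n : ℕ} (bs : List (ℕ × ℕ)) → All (ValidBlock n) bs → Unique (map proj₁ bs) →
    LcmPermFamily n (concatMap blockDomain bs) (blockCount bs)
  blocksFamily [] _ _ = emptyFamily
  blocksFamily ((m , a) ∷ bs) (valid ∷ valids) (m∉ms ∷ ms!) =
    family-++ disjoint (blockFamily valid) (blocksFamily bs valids ms!)
    where
    disjoint : Disjoint (blockDomain (m , a)) (concatMap blockDomain bs)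
    disjoint (v∈ , v∈rest) with find (∈-concatMap⁻ blockDomain {xs = bs} v∈rest)
    ... | (m' , a') , bl∈bs , v∈' with ∈-map⁻ (m *_) v∈ | ∈-map⁻ (m' *_) v∈' | All.lookup valids bl∈bs
    ... | d , d∈ , refl | d' , d'∈ , md≡m'd' | m'⊥b , _ = All.lookup m∉ms (∈-map⁺ proj₁ bl∈bs)
      (coprime-factor-unique (proj₁ valid) m'⊥b (proj₁ (∈-s⁻ d∈)) (proj₁ (∈-s⁻ d'∈)) md≡m'd')

  residues : List ℕ
  residues = filter (λ r → coprime? r b) (range1 b)

  coprimeFrom : ℕ → ℕ → List ℕ
  coprimeFrom j zero = []
  coprimeFrom j (suc L) = map (b * j +_) residues ++ coprimeFrom (suc j) L

  length-coprimeFrom : (j L : ℕ) → length (coprimeFrom j L) ≡ φ b * L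
  length-coprimeFrom j zero = sym (*-zeroʳ (φ b))
  length-coprimeFrom j (suc L) = begin
    length (map (b * j +_) residues ++ coprimeFrom (suc j) L)          ≡⟨ length-++ (map (b * j +_) residues) ⟩
    length (map (b * j +_) residues) + length (coprimeFrom (suc j) L)  ≡⟨ cong₂ _+_ (length-map (b * j +_) residues)
                                                                                        (length-coprimeFrom (suc j) L) ⟩
    φ b + φ b * L                                                      ≡⟨ sym (*-suc (φ b) L) ⟩
    φ b * suc L                                                        ∎
    where open ≡-Reasoning

  coprimeFrom-coprime : (j L : ℕ) → All (λ m → Coprime m b) (coprimeFrom j L)
  coprimeFrom-coprime j zero = []
  coprimeFrom-coprime j (suc L) = All.++⁺
    (All.map⁺ (All.tabulate λ r∈ → coprime-+-multiple j (proj₂ (∈-filter⁻ (λ r → coprime? r b) {xs = range1 b} r∈))))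
    (coprimeFrom-coprime (suc j) L)

  residueBlock-bounds : (j : ℕ) → All (λ m → b * j < m × m ≤ b * suc j) (map (b * j +_) residues)
  residueBlock-bounds j = All.map⁺ (All.tabulate λ r∈ →
    let 1≤r , r≤b = ∈-range1⁻ (proj₁ (∈-filter⁻ (λ r → coprime? r b) {xs = range1 b} r∈))
    in m<m+n (b * j) 1≤r , ≤-trans (+-monoʳ-≤ (b * j) r≤b) (≤-reflexive (trans (+-comm (b * j) b) (sym (*-suc b j)))))

  coprimeFrom-bounds : (j L : ℕ) → All (λ m → b * j < m × m ≤ b * (j + L)) (coprimeFrom j L)
  coprimeFrom-bounds j zero = []
  coprimeFrom-bounds j (suc L) =
    All.++⁺ (All.map (Product.map₂ (λ m≤ → ≤-trans m≤ b[1+j]≤b[j+1+L])) (residueBlock-bounds j))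
            (All.map widen (coprimeFrom-bounds (suc j) L))
    where
    b[1+j]≤b[j+1+L] : b * suc j ≤ b * (j + suc L)
    b[1+j]≤b[j+1+L] = *-monoʳ-≤ b (≤-trans (s≤s (m≤m+n j L)) (≤-reflexive (sym (+-suc j L))))
    widen : ∀ {m} → b * suc j < m × m ≤ b * (suc j + L) → b * j < m × m ≤ b * (j + suc L)
    widen {m} (b[1+j]<m , m≤) =
      <-≤-trans (*-monoʳ-< b (n<1+n j)) (<⇒≤ b[1+j]<m) , subst (λ x → m ≤ b * x) (sym (+-suc j L)) m≤

  Unique-coprimeFrom : (j L : ℕ) → Unique (coprimeFrom j L)
  Unique-coprimeFrom j zero = []
  Unique-coprimeFrom j (suc L) =
    Unique.++⁺ (Unique.map⁺ (+-cancelˡ-≡ (b * j) _ _) (Unique.filter⁺ _ (Unique-range1 b)))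
               (Unique-coprimeFrom (suc j) L) disjoint
    where
    disjoint : Disjoint (map (b * j +_) residues) (coprimeFrom (suc j) L)
    disjoint (v∈ , v∈rest) =
      <⇒≱ (proj₁ (All.lookup (coprimeFrom-bounds (suc j) L) v∈rest)) (proj₂ (All.lookup (residueBlock-bounds j) v∈))

  layer : ℕ → ℕ → ℕ → List (ℕ × ℕ)
  layer lo hi a = map (_, a) (coprimeFrom lo (hi ∸ lo))

  layers : ℕ → List ℕ → List (ℕ × ℕ)
  layers M [] = []
  layers M (a ∷ []) = layer 0 M b
  layers M (a ∷ a' ∷ as) = layer (M * quot b a') (M * quot b a) a ++ layers M (a' ∷ as)

  layerProduct : List ℕ → ℕ
  layerProduct ds = product (map (λ pr → p (proj₁ pr) b ^ (quot b (proj₁ pr) ∸ quot b (proj₂ pr))) (consecutive ds))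

  layer-multipliers : (lo hi a : ℕ) → map proj₁ (layer lo hi a) ≡ coprimeFrom lo (hi ∸ lo)
  layer-multipliers lo hi a = trans (sym (map-∘ (coprimeFrom lo (hi ∸ lo)))) (map-id (coprimeFrom lo (hi ∸ lo)))

  layer-bounds : {lo hi : ℕ} (a : ℕ) → lo ≤ hi → All (λ bl → b * lo < proj₁ bl × proj₁ bl ≤ b * hi) (layer lo hi a)
  layer-bounds {lo} {hi} a lo≤hi = All.map⁺ (All.map (Product.map₂ hi-bound) (coprimeFrom-bounds lo (hi ∸ lo)))
    where
    hi-bound : ∀ {m} → m ≤ b * (lo + (hi ∸ lo)) → m ≤ b * hi
    hi-bound {m} = subst (λ x → m ≤ b * x) (m+[n∸m]≡n lo≤hi)

  layer-valid : {n lo hi : ℕ} (a : ℕ) → lo ≤ hi → b * hi * a ≤ n → All (ValidBlock n) (layer lo hi a)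
  layer-valid {n} {lo} {hi} a lo≤hi bha≤n =
    All.map⁺ (All.zipWith valid (coprimeFrom-coprime lo (hi ∸ lo) , coprimeFrom-bounds lo (hi ∸ lo)))
    where
    valid : ∀ {m} → Coprime m b × (b * lo < m × m ≤ b * (lo + (hi ∸ lo))) → ValidBlock n (m , a)
    valid {m} (m⊥b , b*lo<m , m≤) =
      m⊥b , ≤-trans (s≤s z≤n) b*lo<m , ≤-trans (*-monoˡ-≤ a (subst (λ x → m ≤ b * x) (m+[n∸m]≡n lo≤hi) m≤)) bha≤n

  blockCount-++ : (bs bs' : List (ℕ × ℕ)) → blockCount (bs ++ bs') ≡ blockCount bs * blockCount bs'
  blockCount-++ bs bs' = trans (cong product (map-++ _ bs bs')) (product-++ (map _ bs) _)

  blockCount-layer : (lo hi a : ℕ) → blockCount (layer lo hi a) ≡ p a b ^ (φ b * (hi ∸ lo))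
  blockCount-layer lo hi a =
    trans (constant (coprimeFrom lo (hi ∸ lo))) (cong (p a b ^_) (length-coprimeFrom lo (hi ∸ lo)))
    where
    constant : (ms : List ℕ) → blockCount (map (_, a) ms) ≡ p a b ^ length ms
    constant [] = refl
    constant (m ∷ ms) = cong (p a b *_) (constant ms)

  layer-lo≤hi : (M : ℕ) {a a' : ℕ} → a ∈ range1 b → a ≤ a' → M * quot b a' ≤ M * quot b a
  layer-lo≤hi M a∈ a≤a' = *-monoʳ-≤ M (quot-antitone b (proj₁ (∈-range1⁻ a∈)) a≤a')

  b*[M*b/a]*a≤b*b*M : (M a : ℕ) → b * (M * quot b a) * a ≤ b * b * M
  b*[M*b/a]*a≤b*b*M M a = begin
    b * (M * quot b a) * a   ≡⟨ reassoc b M (quot b a) a ⟩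
    b * M * (quot b a * a)   ≤⟨ *-monoʳ-≤ (b * M) (quot*≤ b a) ⟩
    b * M * b                ≡⟨ xy∙z≈xz∙y b M b ⟩
    b * b * M                ∎
    where
    open ≤-Reasoning
    reassoc : (x y z w : ℕ) → x * (y * z) * w ≡ x * y * (z * w)
    reassoc = solve-∀

  layers-≤ : (M a : ℕ) (as : List ℕ) → Linked _≤_ (a ∷ as) → All (_∈ range1 b) (a ∷ as) →
    All (λ bl → proj₁ bl ≤ b * (M * quot b a)) (layers M (a ∷ as))
  layers-≤ M a [] _ (a∈ ∷ []) =
    All.map (λ m≤bM → ≤-trans (proj₂ m≤bM) (*-monoʳ-≤ b M≤M*[b/a])) (layer-bounds b z≤n)
    where
    M≤M*[b/a] : M ≤ M * quot b a
    M≤M*[b/a] = m≤m*n M (quot b a) {{>-nonZero (uncurry quot-positive (∈-range1⁻ a∈))}}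
  layers-≤ M a (a' ∷ as) (a≤a' ∷ sorted) (a∈ ∷ as⊆[b]) =
    All.++⁺ (All.map proj₂ (layer-bounds a (layer-lo≤hi M a∈ a≤a')))
            (All.map (λ m≤ → ≤-trans m≤ (*-monoʳ-≤ b (layer-lo≤hi M a∈ a≤a'))) (layers-≤ M a' as sorted as⊆[b]))

  Unique-layers : (M a : ℕ) (as : List ℕ) → Linked _≤_ (a ∷ as) → All (_∈ range1 b) (a ∷ as) →
    Unique (map proj₁ (layers M (a ∷ as)))
  Unique-layers M a [] _ _ = subst Unique (sym (layer-multipliers 0 M b)) (Unique-coprimeFrom 0 M)
  Unique-layers M a (a' ∷ as) (a≤a' ∷ sorted) (a∈ ∷ as⊆[b]) =
    subst Unique (sym (map-++ proj₁ (layer lo hi a) (layers M (a' ∷ as))))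
      (Unique.++⁺ (subst Unique (sym (layer-multipliers lo hi a)) (Unique-coprimeFrom lo (hi ∸ lo)))
                  (Unique-layers M a' as sorted as⊆[b]) disjoint)
    where
    lo = M * quot b a'
    hi = M * quot b a
    disjoint : Disjoint (map proj₁ (layer lo hi a)) (map proj₁ (layers M (a' ∷ as)))
    disjoint (v∈ , v∈rest) with ∈-map⁻ proj₁ v∈ | ∈-map⁻ proj₁ v∈rest
    ... | bl , bl∈ , refl | bl' , bl'∈ , v≡ = <⇒≱ (proj₁ (All.lookup (layer-bounds a (layer-lo≤hi M a∈ a≤a')) bl∈))
      (subst (_≤ b * lo) (sym v≡) (All.lookup (layers-≤ M a' as sorted as⊆[b]) bl'∈))

  layers-valid : {n : ℕ} (M a : ℕ) (as : List ℕ) → b * b * M ≤ n →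
    Linked _≤_ (a ∷ as) → All (_∈ range1 b) (a ∷ as) → All (ValidBlock n) (layers M (a ∷ as))
  layers-valid M a [] bbM≤n _ _ =
    layer-valid b z≤n (≤-trans (≤-reflexive (xy∙z≈xz∙y b M b)) bbM≤n)
  layers-valid M a (a' ∷ as) bbM≤n (a≤a' ∷ sorted) (a∈ ∷ as⊆[b]) =
    All.++⁺ (layer-valid a (layer-lo≤hi M a∈ a≤a') (≤-trans (b*[M*b/a]*a≤b*b*M M a) bbM≤n))
            (layers-valid M a' as bbM≤n sorted as⊆[b])

  layers-count : (M a : ℕ) (as : List ℕ) →
    blockCount (layers M (a ∷ as)) ≡ layerProduct (a ∷ as) ^ (φ b * M) * p b b ^ (φ b * M)
  layers-count M a [] =
    trans (blockCount-layer 0 M b) (sym (trans (cong (_* p b b ^ (φ b * M)) (^-zeroˡ (φ b * M))) (*-identityˡ _)))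
  layers-count M a (a' ∷ as) = begin
    blockCount (layer lo hi a ++ layers M (a' ∷ as))            ≡⟨ blockCount-++ (layer lo hi a) (layers M (a' ∷ as)) ⟩
    blockCount (layer lo hi a) * blockCount (layers M (a' ∷ as)) ≡⟨ cong₂ _*_ (blockCount-layer lo hi a) (layers-count M a' as) ⟩
    p a b ^ (φ b * (hi ∸ lo)) * (C ^ e * P ^ e)                 ≡⟨ cong (λ x → p a b ^ x * (C ^ e * P ^ e)) exponent ⟩
    p a b ^ (d * e) * (C ^ e * P ^ e)                            ≡⟨ cong (_* (C ^ e * P ^ e)) (sym (^-*-assoc (p a b) d e)) ⟩
    (p a b ^ d) ^ e * (C ^ e * P ^ e)                            ≡⟨ sym (*-assoc ((p a b ^ d) ^ e) (C ^ e) (P ^ e)) ⟩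
    (p a b ^ d) ^ e * C ^ e * P ^ e                              ≡⟨ cong (_* P ^ e) (sym (^-distribʳ-* (p a b ^ d) C e)) ⟩
    (p a b ^ d * C) ^ e * P ^ e                                  ∎
    where
    open ≡-Reasoning
    lo = M * quot b a'
    hi = M * quot b a
    d = quot b a ∸ quot b a'
    e = φ b * M
    C = layerProduct (a' ∷ as)
    P = p b b
    exponent : φ b * (hi ∸ lo) ≡ d * e
    exponent = trans (cong (φ b *_) (sym (*-distribˡ-∸ M (quot b a) (quot b a')))) (x∙yz≈z∙xy (φ b) M d)

  divisors⊆[b] : All (_∈ range1 b) (divisors b)
  divisors⊆[b] = All.tabulate (proj₁ ∘ ∈-filter⁻ (_∣? b) {xs = range1 b})

  divisors-sorted : Linked _≤_ (divisors b)
  divisors-sorted =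
    Linked.filter⁺ (_∣? b) ≤-trans (Linked.map⁺ (Linked.applyUpTo⁺₂ (λ i → i) b (λ i → n≤1+n (suc i))))

  divisors-∷ : ∃[ a ] ∃[ as ] (divisors b ≡ a ∷ as)
  divisors-∷ with divisors b in eq
  ... | a ∷ as = a , as , refl
  ... | [] = contradiction (subst (b ∈_) eq (∈-filter⁺ (_∣? b) (∈-range1⁺ (>-nonZero⁻¹ b) ≤-refl) ∣-refl)) λ ()

  τ!≤p[b,b] : τ b ! ≤ p b b
  τ!≤p[b,b] = subst (λ ds → length ds ! ≤ p b b) s[b,b]≡divisors
    (family≤count (completeFamily (Unique-s b) (All.tabulate (proj₂ ∘ ∈-s⁻))
      (λ d∈ e∈ → ∣⇒≤ (lcm-least (proj₁ (∈-s⁻ d∈)) (proj₁ (∈-s⁻ e∈))))))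
    where
    s[b,b]≡divisors : s b b ≡ divisors b
    s[b,b]≡divisors = filter-≐ (λ d → (d ∣? b) ×-dec (d ≤? b)) (_∣? b) (proj₁ , λ d∣b → d∣b , ∣⇒≤ d∣b) (range1 b)

  Q^φM≤#Slcm : {n : ℕ} (M : ℕ) → b * b * M ≤ n → Q b ^ (φ b * M) ≤ #Slcm n
  Q^φM≤#Slcm {n} M bbM≤n with divisors-∷
  ... | a , as , ds≡a∷as = begin
    Q b ^ e                                       ≡⟨ ^-distribʳ-* (τ b !) (layerProduct (divisors b)) e ⟩
    (τ b !) ^ e * layerProduct (divisors b) ^ e   ≤⟨ *-monoˡ-≤ _ (^-monoˡ-≤ e τ!≤p[b,b]) ⟩
    p b b ^ e * layerProduct (divisors b) ^ e     ≡⟨ *-comm (p b b ^ e) _ ⟩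
    layerProduct (divisors b) ^ e * p b b ^ e     ≡⟨ cong (λ ds → layerProduct ds ^ e * p b b ^ e) ds≡a∷as ⟩
    layerProduct (a ∷ as) ^ e * p b b ^ e         ≡⟨ sym (layers-count M a as) ⟩
    blockCount (layers M (a ∷ as))                ≤⟨ family≤#Slcm (blocksFamily (layers M (a ∷ as)) valid distinct) ⟩
    #Slcm n                                       ∎
    where
    open ≤-Reasoning
    e = φ b * M
    sorted = subst (Linked _≤_) ds≡a∷as divisors-sorted
    bounded = subst (All (_∈ range1 b)) ds≡a∷as divisors⊆[b]
    valid = layers-valid M a as bbM≤n sorted bounded
    distinct = Unique-layers M a as sorted bounded

  Q^φn≤ : (n : ℕ) → Q b ^ (φ b * n) ≤ suc (Q b) ^ (φ b * (b * b)) * #Slcm n ^ (b * b)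
  Q^φn≤ n = begin
    Q b ^ (φ b * n)                            ≡⟨ cong (Q b ^_) exponent ⟩
    Q b ^ (φ b * r + φ b * M * bb)             ≡⟨ ^-distribˡ-+-* (Q b) (φ b * r) (φ b * M * bb) ⟩
    Q b ^ (φ b * r) * Q b ^ (φ b * M * bb)     ≡⟨ cong (Q b ^ (φ b * r) *_) (sym (^-*-assoc (Q b) (φ b * M) bb)) ⟩
    Q b ^ (φ b * r) * (Q b ^ (φ b * M)) ^ bb   ≤⟨ *-mono-≤ remainder≤ (^-monoˡ-≤ bb (Q^φM≤#Slcm M bbM≤n)) ⟩
    suc (Q b) ^ (φ b * bb) * #Slcm n ^ bb      ∎
    where
    open ≤-Reasoning
    bb = b * b
    instance
      bb≢0 : NonZero bb
      bb≢0 = m*n≢0 b b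
    M = n / bb
    r = n % bb
    exponent : φ b * n ≡ φ b * r + φ b * M * bb
    exponent = trans (cong (φ b *_) (m≡m%n+[m/n]*n n bb))
                     (trans (*-distribˡ-+ (φ b) r (M * bb)) (cong (φ b * r +_) (sym (*-assoc (φ b) M bb))))
    bbM≤n : bb * M ≤ n
    bbM≤n = subst (_≤ n) (*-comm M bb) (m/n*n≤m n bb)
    remainder≤ : Q b ^ (φ b * r) ≤ suc (Q b) ^ (φ b * bb)
    remainder≤ =
      ≤-trans (^-monoˡ-≤ (φ b * r) (n≤1+n (Q b))) (^-monoʳ-≤ (suc (Q b)) (*-monoʳ-≤ (φ b) (<⇒≤ (m%n<n n bb))))

theorem2 : (b : ℕ) → 1 ≤ b → (k : ℕ) →
    ∃[ N ] ((n : ℕ) → N ≤ n →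
      Q b ^ (φ b * n) * suc k ^ n ≤ #Slcm n ^ (b * b) * suc (suc k) ^ n)
theorem2 b@(suc _) _ k = C * suc k , λ n C[1+k]≤n → begin
  Q b ^ (φ b * n) * suc k ^ n          ≤⟨ *-monoˡ-≤ (suc k ^ n) (Q^φn≤ b n) ⟩
  C * #Slcm n ^ (b * b) * suc k ^ n    ≡⟨ xy∙z≈y∙xz C (#Slcm n ^ (b * b)) (suc k ^ n) ⟩
  #Slcm n ^ (b * b) * (C * suc k ^ n)  ≤⟨ *-monoʳ-≤ (#Slcm n ^ (b * b)) (exp-dominates {C} C[1+k]≤n) ⟩
  #Slcm n ^ (b * b) * suc (suc k) ^ n  ∎
  where
  open ≤-Reasoning
  C = suc (Q b) ^ (φ b * (b * b))
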